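{- Let $d\ge3$, $h\ge1$ and $1\le n\le h$. Let $\mathbf{y}_n=\sum_{i\in S_n}\mathbf{x}_i$, where $S_n$ is the set of vertices of $\mathcal{T}(d,h)$ at depth $n$. Then the order of $\bar{\mathbf{y}}_n$ in the sandpile group $G(d,h)$ is $(d-1)^{h+1-n}$.
   Context: Let $\mathcal{T}(d,h)$ be the ball of radius $h$ about a root vertex $0$ in the infinite $d$-regular tree (root has $d$ children, vertices at depth $1,\dots,h-1$ have $d-1$ children, depth-$h$ vertices are leaves; depth is the distance from $0$). Let $V$ be its vertex set, $p(i)$ the parent of $i\neq 0$, $C_i$ the children of $i$, $\{\mathbf{x}_i\}$ the standard basis of $\mathbb{Z}^V$, and $\delta_i = d\mathbf{x}_i - \mathbf{x}_{p(i)} - \sum_{j\in C_i}\mathbf{x}_j$ (omit $\mathbf{x}_{p(i)}$ for $i=0$). The sandpile group is $G(d,h)=\mathbb{Z}^V/\sum_{i\in V}\mathbb{Z}\delta_i$, and $\bar{\mathbf{v}}$ denotes the image of $\mathbf{v}\in\mathbb{Z}^V$. -}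

module Defs where

open import Data.Nat as ℕ using (ℕ; zero; suc; _<ᵇ_; _≤ᵇ_; _∸_)
open import Data.Integer as ℤ using (ℤ; +_; _-_; _*_)
open import Data.Bool using (Bool; true; false; _∧_; T; if_then_else_)
open import Data.List using (List; []; _∷_; length; map; foldr)
open import Data.List.Properties using (≡-dec)
open import Data.Product using (Σ; _×_; _,_; proj₁; ∃)
open import Relation.Nullary using (Dec; yes; no; ¬_; does)
open import Relation.Binary.PropositionalEquality using (_≡_)

-- Vertices of T(d,h) are encoded by addresses: lists of child indices,
-- stored in REVERSE order (head = last step).
-- The first step (child of root) ranges over 0..d-1, every later step
-- over 0..d-2.  Depth = length.
validPath : ℕ → List ℕ → Bool
validPath d []            = true
validPath d (x ∷ [])      = x <ᵇ d
validPath d (x ∷ y ∷ r)   = (x <ᵇ (d ∸ 1)) ∧ validPath d (y ∷ r)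

isVertex : ℕ → ℕ → List ℕ → Bool
isVertex d h a = (length a ≤ᵇ h) ∧ validPath d a

Vertex : ℕ → ℕ → Set
Vertex d h = Σ (List ℕ) (λ a → T (isVertex d h a))

addr : ∀ {d h} → Vertex d h → List ℕ
addr = proj₁

depth : ∀ {d h} → Vertex d h → ℕ
depth v = length (addr v)

_≟a_ : (a b : List ℕ) → Dec (a ≡ b)
_≟a_ = ≡-dec ℕ._≟_

ind : ∀ {p} {P : Set p} → Dec P → ℤ
ind (yes _) = + 1
ind (no _)  = + 0

isParentOf : List ℕ → List ℕ → Bool
isParentOf j []      = false
isParentOf j (_ ∷ a) = does (j ≟a a)


indB : Bool → ℤ
indB true  = + 1
indB false = + 0

ZV : ℕ → ℕ → Set
ZV d h = Vertex d h → ℤ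

x : ∀ {d h} → Vertex d h → ZV d h
x i j = ind (addr i ≟a addr j)

-- δ_i = d x_i - x_{p(i)} - Σ_{j ∈ C_i} x_j   (x_{p(i)} omitted for the root);
-- coordinate at j: d[j = i] - [j = p(i)] - [j ∈ C_i]  (j ∈ C_i iff i = p(j))
δ : ∀ d {h} → Vertex d h → ZV d h
δ d i j = ((+ d) * x i j - indB (isParentOf (addr j) (addr i)))
          - indB (isParentOf (addr i) (addr j))

comb : ∀ d {h} → List (Vertex d h × ℤ) → ZV d h
comb d cs j = foldr ℤ._+_ (+ 0) (map (λ { (i , c) → c * δ d i j }) cs)

InLattice : ∀ d h → ZV d h → Set
InLattice d h v = ∃ λ (cs : List (Vertex d h × ℤ)) → ∀ j → v j ≡ comb d cs j

_·_ : ∀ {d h} → ℕ → ZV d h → ZV d h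
(k · v) j = (+ k) * v j

IsOrderOf : ∀ d h → ℕ → ZV d h → Set
IsOrderOf d h k v =
  (0 ℕ.< k) × InLattice d h (k · v) ×
  (∀ m → 0 ℕ.< m → m ℕ.< k → ¬ InLattice d h (m · v))

y : ∀ d h → ℕ → ZV d h
y d h n j = ind (depth j ℕ.≟ n)

module Submission where

-- For a weight w depending only on the depth, the pairing of w with the row δ_j of the Laplacian
-- depends only on the depth t of j: it is Δ w t = d·w(t) − w(t − 1) − b(t)·w(t + 1), where the
-- middle term is absent at the root and b(t) is the number of children of a vertex of depth t
-- (0 at depth h). Put D = d − 1. The weight φ(t) = 1 + D + ⋯ + D^(h − t) is harmonic except at
-- the root, where Δ φ 0 = d·D^h, so ⟨φ, v⟩ is a multiple of d·D^h for every v in the lattice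
-- Σ ℤ δ_i. Level n has d·D^(n − 1) vertices, so ⟨φ, m·y_n⟩ = m·d·D^(n − 1)·φ(n); as
-- φ(n) ≡ 1 (mod D), m·y_n in the lattice forces D^(h + 1 − n) ∣ m. Conversely the truncated
-- weight φ(max(t, n)) has Δ = D^(h + 1 − n)·[t = n], which writes D^(h + 1 − n)·y_n as
-- Σ_i φ(max(depth i, n))·δ_i.

open import Defs
open import Data.Nat as ℕ using (ℕ; zero; suc; _∸_; _^_; _≤_; _<_; z≤n; s≤s)
import Data.Nat.Properties as ℕ
open import Data.Nat.Divisibility
  using (_∣_; divides; ∣⇒≤; ∣-trans; 1∣_; ∣1⇒≡1; ∣m+n∣m⇒∣n; m∣m*n; *-monoʳ-∣; *-cancelˡ-∣)
open import Data.Nat.Coprimality as Coprime using (Coprime; coprime-divisor)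
open import Data.Integer as ℤ using (ℤ; +_)
import Data.Integer.Properties as ℤ
open import Data.Integer.Tactic.RingSolver using (solve-∀)
import Algebra.Properties.CommutativeSemigroup ℕ.*-commutativeSemigroup as ℕ*
import Algebra.Properties.CommutativeSemigroup ℤ.*-commutativeSemigroup as ℤ*
open import Data.Bool using (T)
open import Data.Bool.Properties using (T-∧)
open import Data.List using (List; []; _∷_; _++_; length; map; concatMap; downFrom)
open import Data.List.Properties using (length-downFrom; ∷-injectiveˡ; ∷-injectiveʳ)
open import Data.List.Relation.Unary.All as All using (All; []; _∷_)
import Data.List.Relation.Unary.All.Properties as AllP
open import Data.Product using (_×_; _,_; proj₁; proj₂)
open import Data.Sum using (_⊎_; inj₁; inj₂)
open import Function using (_∘_; id)
open import Function.Bundles using (Equivalence)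
open import Relation.Binary using (tri<; tri≈; tri>)
open import Relation.Binary.PropositionalEquality
open import Relation.Nullary using (Dec; yes; no; ¬_; does; contradiction)

module FiniteSums where

  open import Data.Integer using (_+_; _-_; _*_)

  ∑ : {A : Set} → List A → (A → ℤ) → ℤ
  ∑ []       F = + 0
  ∑ (a ∷ as) F = F a + ∑ as F

  syntax ∑ xs (λ a → e) = ∑[ a ∈ xs ] e

  private variable
    A B : Set

  ∑-cong : (xs : List A) {F G : A → ℤ} → (∀ a → F a ≡ G a) → ∑ xs F ≡ ∑ xs G
  ∑-cong []       F≗G = refl
  ∑-cong (a ∷ xs) F≗G = cong₂ _+_ (F≗G a) (∑-cong xs F≗G)

  ∑-congᴬ : {xs : List A} {F G : A → ℤ} → All (λ a → F a ≡ G a) xs → ∑ xs F ≡ ∑ xs G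
  ∑-congᴬ []           = refl
  ∑-congᴬ (eq ∷ eqs) = cong₂ _+_ eq (∑-congᴬ eqs)

  ∑-zero : (xs : List A) {F : A → ℤ} → (∀ a → F a ≡ + 0) → ∑ xs F ≡ + 0
  ∑-zero []       F≗0 = refl
  ∑-zero (a ∷ xs) F≗0 = cong₂ _+_ (F≗0 a) (∑-zero xs F≗0)

  ∑-++ : (xs ys : List A) (F : A → ℤ) → ∑ (xs ++ ys) F ≡ ∑ xs F + ∑ ys F
  ∑-++ []       ys F = sym (ℤ.+-identityˡ _)
  ∑-++ (a ∷ xs) ys F = trans (cong (_+_ (F a)) (∑-++ xs ys F)) (sym (ℤ.+-assoc (F a) _ _))

  ∑-*ˡ : (xs : List A) (k : ℤ) (F : A → ℤ) → ∑[ a ∈ xs ] (k * F a) ≡ k * ∑ xs F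
  ∑-*ˡ []       k F = sym (ℤ.*-zeroʳ k)
  ∑-*ˡ (a ∷ xs) k F = trans (cong (_+_ (k * F a)) (∑-*ˡ xs k F)) (sym (ℤ.*-distribˡ-+ k (F a) _))

  ∑-- : (xs : List A) (F G : A → ℤ) → ∑[ a ∈ xs ] (F a - G a) ≡ ∑ xs F - ∑ xs G
  ∑-- []       F G = refl
  ∑-- (a ∷ xs) F G = trans (cong (_+_ (F a - G a)) (∑-- xs F G)) (interchange (F a) (G a) _ _)
    where
    interchange : ∀ p q r s → (p - q) + (r - s) ≡ (p + r) - (q + s)
    interchange = solve-∀

  ∑-const : (xs : List A) (k : ℤ) → ∑[ a ∈ xs ] k ≡ + length xs * k
  ∑-const []       k = refl
  ∑-const (a ∷ xs) k = begin
    k + ∑[ a ∈ xs ] k            ≡⟨ cong (_+_ k) (∑-const xs k) ⟩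
    k + + length xs * k          ≡⟨ cong (_+ + length xs * k) (sym (ℤ.*-identityˡ k)) ⟩
    + 1 * k + + length xs * k    ≡⟨ sym (ℤ.*-distribʳ-+ k (+ 1) (+ length xs)) ⟩
    + suc (length xs) * k        ∎
    where open ≡-Reasoning

  ∑-comm : (xs : List A) (ys : List B) (F : A → B → ℤ) →
           ∑[ a ∈ xs ] (∑[ b ∈ ys ] F a b) ≡ ∑[ b ∈ ys ] (∑[ a ∈ xs ] F a b)
  ∑-comm xs []       F = ∑-zero xs (λ _ → refl)
  ∑-comm xs (b ∷ ys) F = trans (∑-+ xs (λ a → F a b) (λ a → ∑[ b ∈ ys ] F a b))
                               (cong (_+_ (∑[ a ∈ xs ] F a b)) (∑-comm xs ys F))
    where
    ∑-+ : (xs : List A) (F G : A → ℤ) → ∑[ a ∈ xs ] (F a + G a) ≡ ∑ xs F + ∑ xs G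
    ∑-+ []       F G = refl
    ∑-+ (a ∷ xs) F G = trans (cong (_+_ (F a + G a)) (∑-+ xs F G)) (interchange (F a) (G a) _ _)
      where
      interchange : ∀ p q r s → (p + q) + (r + s) ≡ (p + r) + (q + s)
      interchange = solve-∀

  ∑-concatMap : (f : A → List B) (xs : List A) (F : B → ℤ) →
                ∑ (concatMap f xs) F ≡ ∑[ a ∈ xs ] ∑ (f a) F
  ∑-concatMap f []       F = refl
  ∑-concatMap f (a ∷ xs) F = trans (∑-++ (f a) (concatMap f xs) F)
                                   (cong (_+_ (∑ (f a) F)) (∑-concatMap f xs F))

  ∑-map : (f : A → B) (xs : List A) (F : B → ℤ) → ∑ (map f xs) F ≡ ∑[ a ∈ xs ] F (f a)
  ∑-map f []       F = refl
  ∑-map f (a ∷ xs) F = cong (_+_ (F (f a))) (∑-map f xs F)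

  ∑-toList : {P : A → Set} {xs : List A} (ps : All P xs) (F : A → ℤ) →
             ∑[ p ∈ All.toList ps ] F (proj₁ p) ≡ ∑ xs F
  ∑-toList []       F = refl
  ∑-toList (p ∷ ps) F = cong (_+_ (F _)) (∑-toList ps F)

  ind-yes : {P : Set} (D : Dec P) → P → ind D ≡ + 1
  ind-yes (yes _) _ = refl
  ind-yes (no ¬p) p = contradiction p ¬p

  ind-no : {P : Set} (D : Dec P) → ¬ P → ind D ≡ + 0
  ind-no (yes p) ¬p = contradiction p ¬p
  ind-no (no _)  _  = refl

  ind-⇔ : {P Q : Set} (D : Dec P) (E : Dec Q) → (P → Q) → (Q → P) → ind D ≡ ind E
  ind-⇔ D (yes q) _   Q→P = ind-yes D (Q→P q)
  ind-⇔ D (no ¬q) P→Q _   = ind-no D (¬q ∘ P→Q)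

  ind-sym : {a b : A} (D : Dec (a ≡ b)) (E : Dec (b ≡ a)) → ind D ≡ ind E
  ind-sym D E = ind-⇔ D E sym sym

  indB-does : {P : Set} (D : Dec P) → indB (does D) ≡ ind D
  indB-does (yes _) = refl
  indB-does (no _)  = refl

  ∑-ind-downFrom : ∀ b c₀ (K : ℕ → ℤ) →
                   ∑[ c ∈ downFrom b ] (ind (c₀ ℕ.≟ c) * K c) ≡ ind (c₀ ℕ.<? b) * K c₀
  ∑-ind-downFrom zero    c₀ K = sym (cong (_* K c₀) (ind-no (c₀ ℕ.<? 0) λ ()))
  ∑-ind-downFrom (suc b) c₀ K with c₀ ℕ.≟ b
  ... | yes refl rewrite ∑-ind-downFrom c₀ c₀ K
                       | ind-no (c₀ ℕ.<? c₀) (ℕ.<-irrefl refl)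
                       | ind-yes (c₀ ℕ.<? suc c₀) ℕ.≤-refl = ℤ.+-identityʳ _
  ... | no c₀≢b = trans (ℤ.+-identityˡ _) (trans (∑-ind-downFrom b c₀ K)
                    (cong (_* K c₀) (ind-⇔ (c₀ ℕ.<? b) (c₀ ℕ.<? suc b) ℕ.m≤n⇒m≤1+n
                                    λ c₀<1+b → ℕ.≤∧≢⇒< (ℕ.≤-pred c₀<1+b) c₀≢b)))

  ∑-downFrom-const : ∀ b (k : ℤ) → ∑[ c ∈ downFrom b ] k ≡ + b * k
  ∑-downFrom-const b k = trans (∑-const (downFrom b) k) (cong (λ n → + n * k) (length-downFrom b))

  ind-∷ : ∀ x y (xs ys : List ℕ) →
          ind ((x ∷ xs) ≟a (y ∷ ys)) ≡ ind (x ℕ.≟ y) * ind (xs ≟a ys)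
  ind-∷ x y xs ys = by-cases (x ℕ.≟ y)
    where
    by-cases : (D : Dec (x ≡ y)) → ind ((x ∷ xs) ≟a (y ∷ ys)) ≡ ind D * ind (xs ≟a ys)
    by-cases (yes refl) =
      trans (ind-⇔ ((x ∷ xs) ≟a (x ∷ ys)) (xs ≟a ys) ∷-injectiveʳ (cong (x ∷_)))
            (sym (ℤ.*-identityˡ _))
    by-cases (no x≢y)   = ind-no ((x ∷ xs) ≟a (y ∷ ys)) (x≢y ∘ ∷-injectiveˡ)

  ind-≟-suc : ∀ m n → ind (m ℕ.≟ n) ≡ ind (suc m ℕ.≟ suc n)
  ind-≟-suc m n = ind-⇔ (m ℕ.≟ n) (suc m ℕ.≟ suc n) (cong suc) ℕ.suc-injective

module Tree (d : ℕ) where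
  open import Data.Integer using (_+_; _-_; _*_)
  open FiniteSums

  branching : ℕ → ℕ
  branching zero    = d
  branching (suc _) = d ∸ 1

  children : List ℕ → List (List ℕ)
  children r = map (_∷ r) (downFrom (branching (length r)))

  level : ℕ → List (List ℕ)
  level zero    = [] ∷ []
  level (suc s) = concatMap children (level s)

  ball : ℕ → List (List ℕ)
  ball h = concatMap level (downFrom (suc h))

  parentWeight : (ℕ → ℤ) → ℕ → ℤ
  parentWeight w zero    = + 0
  parentWeight w (suc t) = w t

  Valid : List ℕ → Set
  Valid u = T (validPath d u)

  valid-∷⁻ : ∀ c u → Valid (c ∷ u) → c < branching (length u) × Valid u
  valid-∷⁻ c []      c<d = ℕ.<ᵇ⇒< c d c<d , _
  valid-∷⁻ c (_ ∷ _) v   = let c<ᵇ , v′ = Equivalence.to T-∧ v in ℕ.<ᵇ⇒< c (d ∸ 1) c<ᵇ , v′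

  valid-∷⁺ : ∀ c u → c < branching (length u) → Valid u → Valid (c ∷ u)
  valid-∷⁺ c []      c<b _ = ℕ.<⇒<ᵇ c<b
  valid-∷⁺ c (_ ∷ _) c<b v = Equivalence.from T-∧ (ℕ.<⇒<ᵇ c<b , v)

  level-valid : ∀ s → All (λ a → Valid a × length a ≡ s) (level s)
  level-valid zero    = (_ , refl) ∷ []
  level-valid (suc s) = AllP.concat⁺ (AllP.map⁺ (All.map children-valid (level-valid s)))
    where
    children-valid : ∀ {r} → Valid r × length r ≡ s →
                     All (λ a → Valid a × length a ≡ suc s) (children r)
    children-valid {r} (v , refl) =
      AllP.map⁺ (AllP.applyDownFrom⁺₁ _ _ λ {c} c<b → valid-∷⁺ c r c<b v , refl)

  ∑-level-point : ∀ s u → Valid u → (G : List ℕ → ℤ) →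
                  ∑[ a ∈ level s ] (ind (u ≟a a) * G a) ≡ ind (length u ℕ.≟ s) * G u
  ∑-level-point zero    []      _ G = ℤ.+-identityʳ _
  ∑-level-point zero    (_ ∷ _) _ G = refl
  ∑-level-point (suc s) []        _ G =
    trans (∑-concatMap children (level s) _)
          (∑-zero (level s) λ r → trans (∑-map (_∷ r) (downFrom (branching (length r))) _)
                                          (∑-zero (downFrom (branching (length r))) λ _ → refl))
  ∑-level-point (suc s) (c₀ ∷ u₀) v G = begin
    ∑[ a ∈ concatMap children (level s) ] (ind ((c₀ ∷ u₀) ≟a a) * G a)
      ≡⟨ ∑-concatMap children (level s) _ ⟩
    ∑[ r ∈ level s ] (∑[ a ∈ children r ] (ind ((c₀ ∷ u₀) ≟a a) * G a))
      ≡⟨ ∑-cong (level s) (λ r → trans (∑-map (_∷ r) (downFrom (branching (length r))) _)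
                                        (factor r)) ⟩
    ∑[ r ∈ level s ] (ind (u₀ ≟a r) * H r)
      ≡⟨ ∑-level-point s u₀ v₀ H ⟩
    ind (length u₀ ℕ.≟ s) * H u₀
      ≡⟨ cong (ind (length u₀ ℕ.≟ s) *_)
              (∑-ind-downFrom (branching (length u₀)) c₀ λ c → G (c ∷ u₀)) ⟩
    ind (length u₀ ℕ.≟ s) * (ind (c₀ ℕ.<? branching (length u₀)) * G (c₀ ∷ u₀))
      ≡⟨ cong₂ (λ i j → i * (j * G (c₀ ∷ u₀))) (ind-≟-suc (length u₀) s)
               (ind-yes (c₀ ℕ.<? branching (length u₀)) c₀<b) ⟩
    ind (suc (length u₀) ℕ.≟ suc s) * (+ 1 * G (c₀ ∷ u₀))
      ≡⟨ cong (ind (suc (length u₀) ℕ.≟ suc s) *_) (ℤ.*-identityˡ _) ⟩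
    ind (suc (length u₀) ℕ.≟ suc s) * G (c₀ ∷ u₀) ∎
    where
    open ≡-Reasoning
    c₀<b : c₀ < branching (length u₀)
    c₀<b = proj₁ (valid-∷⁻ c₀ u₀ v)
    v₀ : Valid u₀
    v₀ = proj₂ (valid-∷⁻ c₀ u₀ v)
    H : List ℕ → ℤ
    H r = ∑[ c ∈ downFrom (branching (length r)) ] (ind (c₀ ℕ.≟ c) * G (c ∷ r))
    factor : ∀ r →
             ∑[ c ∈ downFrom (branching (length r)) ] (ind ((c₀ ∷ u₀) ≟a (c ∷ r)) * G (c ∷ r))
             ≡ ind (u₀ ≟a r) * H r
    factor r = trans (∑-cong (downFrom b) λ c → trans (cong (_* G (c ∷ r)) (ind-∷ c₀ c u₀ r))
                                                       (ℤ*.xy∙z≈y∙xz (ind (c₀ ℕ.≟ c)) _ _))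
                     (∑-*ˡ (downFrom b) (ind (u₀ ≟a r)) λ c → ind (c₀ ℕ.≟ c) * G (c ∷ r))
      where
      b = branching (length r)

  ∑-level-children : ∀ s u → Valid u → (w : ℕ → ℤ) →
                     ∑[ a ∈ level s ] (indB (isParentOf u a) * w (length a))
                     ≡ ind (suc (length u) ℕ.≟ s) * (+ branching (length u) * w (suc (length u)))
  ∑-level-children zero    u v w = refl
  ∑-level-children (suc s) u v w = begin
    ∑[ a ∈ concatMap children (level s) ] (indB (isParentOf u a) * w (length a))
      ≡⟨ ∑-concatMap children (level s) _ ⟩
    ∑[ r ∈ level s ] (∑[ a ∈ children r ] (indB (isParentOf u a) * w (length a)))
      ≡⟨ ∑-cong (level s) (λ r → trans (∑-map (_∷ r) (downFrom (branching (length r))) _)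
                                        (count r)) ⟩
    ∑[ r ∈ level s ] (ind (u ≟a r) * W r)
      ≡⟨ ∑-level-point s u v W ⟩
    ind (length u ℕ.≟ s) * W u
      ≡⟨ cong (_* W u) (ind-≟-suc (length u) s) ⟩
    ind (suc (length u) ℕ.≟ suc s) * W u ∎
    where
    open ≡-Reasoning
    W : List ℕ → ℤ
    W r = + branching (length r) * w (suc (length r))
    count : ∀ r → ∑[ c ∈ downFrom (branching (length r)) ] (indB (does (u ≟a r)) * w (suc (length r)))
                  ≡ ind (u ≟a r) * W r
    count r = trans (∑-downFrom-const b _)
                    (trans (cong (λ i → + b * (i * w (suc (length r)))) (indB-does (u ≟a r)))
                           (ℤ*.x∙yz≈y∙xz (+ b) (ind (u ≟a r)) _))
      where
      b = branching (length r)

  vertex⁺ : ∀ {h} a → Valid a → length a ≤ h → T (isVertex d h a)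
  vertex⁺ {h} a v a≤h = Equivalence.from T-∧ (ℕ.≤⇒≤ᵇ a≤h , v)

  vertex⁻ : ∀ {h} (i : Vertex d h) → Valid (addr i) × depth i ≤ h
  vertex⁻ {h} (a , p) = let a≤ᵇh , v = Equivalence.to T-∧ p in v , ℕ.≤ᵇ⇒≤ (length a) h a≤ᵇh

  ball-vertex : ∀ h → All (λ a → T (isVertex d h a)) (ball h)
  ball-vertex h = AllP.concat⁺ (AllP.map⁺ (AllP.applyDownFrom⁺₁ id (suc h) λ {s} s<1+h →
    All.map (λ { {a} (v , refl) → vertex⁺ a v (ℕ.≤-pred s<1+h) }) (level-valid s)))

  ∑-ball-point : ∀ h u → Valid u → length u ≤ h → (G : List ℕ → ℤ) →
                 ∑[ a ∈ ball h ] (ind (u ≟a a) * G a) ≡ G u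
  ∑-ball-point h u v u≤h G = begin
    ∑[ a ∈ ball h ] (ind (u ≟a a) * G a)
      ≡⟨ ∑-concatMap level (downFrom (suc h)) _ ⟩
    ∑[ s ∈ downFrom (suc h) ] (∑[ a ∈ level s ] (ind (u ≟a a) * G a))
      ≡⟨ ∑-cong (downFrom (suc h)) (λ s → ∑-level-point s u v G) ⟩
    ∑[ s ∈ downFrom (suc h) ] (ind (length u ℕ.≟ s) * G u)
      ≡⟨ ∑-ind-downFrom (suc h) (length u) (λ _ → G u) ⟩
    ind (length u ℕ.<? suc h) * G u
      ≡⟨ cong (_* G u) (ind-yes (length u ℕ.<? suc h) (s≤s u≤h)) ⟩
    + 1 * G u
      ≡⟨ ℤ.*-identityˡ (G u) ⟩
    G u ∎
    where open ≡-Reasoning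

  ∑-ball-children : ∀ h u → Valid u → (w : ℕ → ℤ) →
                    ∑[ a ∈ ball h ] (indB (isParentOf u a) * w (length a))
                    ≡ ind (length u ℕ.<? h) * (+ branching (length u) * w (suc (length u)))
  ∑-ball-children h u v w = begin
    ∑[ a ∈ ball h ] (indB (isParentOf u a) * w (length a))
      ≡⟨ ∑-concatMap level (downFrom (suc h)) _ ⟩
    ∑[ s ∈ downFrom (suc h) ] (∑[ a ∈ level s ] (indB (isParentOf u a) * w (length a)))
      ≡⟨ ∑-cong (downFrom (suc h)) (λ s → ∑-level-children s u v w) ⟩
    ∑[ s ∈ downFrom (suc h) ] (ind (suc (length u) ℕ.≟ s) * X)
      ≡⟨ ∑-ind-downFrom (suc h) (suc (length u)) (λ _ → X) ⟩
    ind (suc (length u) ℕ.<? suc h) * X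
      ≡⟨ cong (_* X) (ind-⇔ (suc (length u) ℕ.<? suc h) (length u ℕ.<? h) ℕ.≤-pred s≤s) ⟩
    ind (length u ℕ.<? h) * X ∎
    where
    open ≡-Reasoning
    X = + branching (length u) * w (suc (length u))

  ∑-ball-parent : ∀ h u → Valid u → length u ≤ h → (w : ℕ → ℤ) →
                  ∑[ a ∈ ball h ] (indB (isParentOf a u) * w (length a)) ≡ parentWeight w (length u)
  ∑-ball-parent h []      _ _   w = ∑-zero (ball h) λ _ → refl
  ∑-ball-parent h (c ∷ r) v c∷r≤h w =
    trans (∑-cong (ball h) λ a → cong (_* w (length a))
                                      (trans (indB-does (a ≟a r)) (ind-sym (a ≟a r) (r ≟a a))))
          (∑-ball-point h r (proj₂ (valid-∷⁻ c r v)) (ℕ.<⇒≤ c∷r≤h) (λ a → w (length a)))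

  ∑-ball-depth : ∀ h n → n ≤ h → (F : ℕ → ℤ) →
                 ∑[ a ∈ ball h ] (F (length a) * ind (length a ℕ.≟ n)) ≡ ∑[ a ∈ level n ] F n
  ∑-ball-depth h n n≤h F = begin
    ∑[ a ∈ ball h ] (F (length a) * ind (length a ℕ.≟ n))
      ≡⟨ ∑-concatMap level (downFrom (suc h)) _ ⟩
    ∑[ s ∈ downFrom (suc h) ] (∑[ a ∈ level s ] (F (length a) * ind (length a ℕ.≟ n)))
      ≡⟨ ∑-cong (downFrom (suc h)) level-sum ⟩
    ∑[ s ∈ downFrom (suc h) ] (ind (n ℕ.≟ s) * (∑[ a ∈ level s ] F s))
      ≡⟨ ∑-ind-downFrom (suc h) n (λ s → ∑[ a ∈ level s ] F s) ⟩
    ind (n ℕ.<? suc h) * (∑[ a ∈ level n ] F n)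
      ≡⟨ cong (_* (∑[ a ∈ level n ] F n)) (ind-yes (n ℕ.<? suc h) (s≤s n≤h)) ⟩
    + 1 * (∑[ a ∈ level n ] F n)
      ≡⟨ ℤ.*-identityˡ _ ⟩
    ∑[ a ∈ level n ] F n ∎
    where
    open ≡-Reasoning
    level-sum : ∀ s → ∑[ a ∈ level s ] (F (length a) * ind (length a ℕ.≟ n))
                      ≡ ind (n ℕ.≟ s) * (∑[ a ∈ level s ] F s)
    level-sum s = trans (∑-congᴬ (All.map (λ { (_ , refl) → swap }) (level-valid s)))
                        (∑-*ˡ (level s) (ind (n ℕ.≟ s)) (λ _ → F s))
      where
      swap : F s * ind (s ℕ.≟ n) ≡ ind (n ℕ.≟ s) * F s
      swap = trans (ℤ.*-comm (F s) _) (cong (_* F s) (ind-sym (s ℕ.≟ n) (n ℕ.≟ s)))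

  ∑-level-suc : ∀ s k → ∑[ a ∈ level (suc s) ] k ≡ ∑[ r ∈ level s ] (+ branching s * k)
  ∑-level-suc s k = trans (∑-concatMap children (level s) λ _ → k)
    (∑-congᴬ (All.map (λ { {r} (_ , refl) → trans (∑-map (_∷ r) (downFrom (branching s)) λ _ → k)
                                                  (∑-downFrom-const (branching s) k) })
                      (level-valid s)))

  ∑-level-const : ∀ s (k : ℤ) → ∑[ a ∈ level (suc s) ] k ≡ + (d ℕ.* (d ∸ 1) ^ s) * k
  ∑-level-const zero    k =
    trans (∑-level-suc 0 k) (trans (ℤ.+-identityʳ _) (cong (λ n → + n * k) (sym (ℕ.*-identityʳ d))))
  ∑-level-const (suc s) k = begin
    ∑[ a ∈ level (suc (suc s)) ] k             ≡⟨ ∑-level-suc (suc s) k ⟩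
    ∑[ r ∈ level (suc s) ] (+ D * k)           ≡⟨ ∑-level-const s (+ D * k) ⟩
    + (d ℕ.* D ^ s) * (+ D * k)                ≡⟨ cong (_* (+ D * k)) (ℤ.pos-* d _) ⟩
    + d * + (D ^ s) * (+ D * k)                ≡⟨ rearrange (+ d) (+ D) (+ (D ^ s)) k ⟩
    + d * (+ D * + (D ^ s)) * k                ≡⟨ cong (λ z → + d * z * k) (ℤ.pos-* D _) ⟨
    + d * + (D ^ suc s) * k                    ≡⟨ cong (_* k) (ℤ.pos-* d _) ⟨
    + (d ℕ.* D ^ suc s) * k                    ∎
    where
    open ≡-Reasoning
    D = d ∸ 1
    rearrange : ∀ p q r k → p * r * (q * k) ≡ p * (q * r) * k
    rearrange = solve-∀

module Radial (d h : ℕ) where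
  open import Data.Integer using (_+_; _-_; _*_)
  open FiniteSums
  open Tree d

  vertices : List (Vertex d h)
  vertices = All.toList (ball-vertex h)

  ⟪_,_⟫ : (ℕ → ℤ) → ZV d h → ℤ
  ⟪ w , v ⟫ = ∑[ i ∈ vertices ] (w (depth i) * v i)

  Δ : (ℕ → ℤ) → ℕ → ℤ
  Δ w t = (+ d * w t - parentWeight w t) - ind (t ℕ.<? h) * (+ branching t * w (suc t))

  Δ-zero : ∀ (w : ℕ → ℤ) {x z i} → w 0 ≡ x → w 1 ≡ z → ind (0 ℕ.<? h) ≡ i →
           Δ w 0 ≡ (+ d * x - + 0) - i * (+ d * z)
  Δ-zero w refl refl refl = refl

  Δ-suc : ∀ (w : ℕ → ℤ) {s x y z i} → w s ≡ x → w (suc s) ≡ y → w (suc (suc s)) ≡ z →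
          ind (suc s ℕ.<? h) ≡ i → Δ w (suc s) ≡ (+ d * y - x) - i * (+ (d ∸ 1) * z)
  Δ-suc w refl refl refl refl = refl

  ⟪⟫-δ : (w : ℕ → ℤ) (j : Vertex d h) → ⟪ w , δ d j ⟫ ≡ Δ w (depth j)
  ⟪⟫-δ w (u , p) = begin
    ⟪ w , δ d (u , p) ⟫
      ≡⟨ ∑-toList (ball-vertex h) _ ⟩
    ∑[ a ∈ ball h ] (w (length a) * ((+ d * ind (u ≟a a) - indB (isParentOf a u))
                                     - indB (isParentOf u a)))
      ≡⟨ ∑-cong (ball h) (λ a → distrib (w (length a)) (ind (u ≟a a)) _ _) ⟩
    ∑[ a ∈ ball h ] ((+ d * self a - up a) - down a)
      ≡⟨ ∑-- (ball h) _ down ⟩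
    ∑[ a ∈ ball h ] (+ d * self a - up a) - ∑ (ball h) down
      ≡⟨ cong (_- ∑ (ball h) down)
              (trans (∑-- (ball h) _ up) (cong (_- ∑ (ball h) up) (∑-*ˡ (ball h) (+ d) self))) ⟩
    (+ d * ∑ (ball h) self - ∑ (ball h) up) - ∑ (ball h) down
      ≡⟨ cong₂ _-_ (cong₂ (λ x y → + d * x - y) (∑-ball-point h u v u≤h (w ∘ length))
                                                 (∑-ball-parent h u v u≤h w))
                   (∑-ball-children h u v w) ⟩
    Δ w (length u) ∎
    where
    open ≡-Reasoning
    self up down : List ℕ → ℤ
    self a = ind (u ≟a a) * w (length a)
    up   a = indB (isParentOf a u) * w (length a)
    down a = indB (isParentOf u a) * w (length a)
    v = proj₁ (vertex⁻ (u , p))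
    u≤h = proj₂ (vertex⁻ (u , p))
    distrib : ∀ x i p c → x * ((+ d * i - p) - c) ≡ (+ d * (i * x) - p * x) - c * x
    distrib x i p c = ring (+ d) x i p c
      where
      ring : ∀ d x i p c → x * ((d * i - p) - c) ≡ (d * (i * x) - p * x) - c * x
      ring = solve-∀

  ⟪⟫-cong : (w : ℕ → ℤ) {v v′ : ZV d h} → (∀ j → v j ≡ v′ j) →
            ⟪ w , v ⟫ ≡ ⟪ w , v′ ⟫
  ⟪⟫-cong w v≗v′ = ∑-cong vertices λ i → cong (w (depth i) *_) (v≗v′ i)

  ⟪⟫-· : (w : ℕ → ℤ) (m : ℕ) (v : ZV d h) → ⟪ w , m · v ⟫ ≡ + m * ⟪ w , v ⟫
  ⟪⟫-· w m v = trans (∑-cong vertices λ i → ℤ*.x∙yz≈y∙xz (w (depth i)) (+ m) (v i))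
                     (∑-*ˡ vertices (+ m) λ i → w (depth i) * v i)

  ⟪⟫-y : (w : ℕ → ℤ) → ∀ n → n ≤ h → ⟪ w , y d h n ⟫ ≡ ∑[ a ∈ level n ] w n
  ⟪⟫-y w n n≤h = trans (∑-toList (ball-vertex h) λ a → w (length a) * ind (length a ℕ.≟ n))
                       (∑-ball-depth h n n≤h w)

  comb-∑ : (cs : List (Vertex d h × ℤ)) (j : Vertex d h) →
           comb d cs j ≡ ∑[ ic ∈ cs ] (proj₂ ic * δ d (proj₁ ic) j)
  comb-∑ []             j = refl
  comb-∑ ((i , c) ∷ cs) j = cong (_+_ (c * δ d i j)) (comb-∑ cs j)

  ⟪⟫-comb : (w : ℕ → ℤ) (cs : List (Vertex d h × ℤ)) →
            ⟪ w , comb d cs ⟫ ≡ ∑[ ic ∈ cs ] (proj₂ ic * ⟪ w , δ d (proj₁ ic) ⟫)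
  ⟪⟫-comb w cs = begin
    ∑[ i ∈ vertices ] (w (depth i) * comb d cs i)
      ≡⟨ ∑-cong vertices (λ i → trans (cong (w (depth i) *_) (comb-∑ cs i))
                                      (sym (∑-*ˡ cs (w (depth i)) _))) ⟩
    ∑[ i ∈ vertices ] (∑[ ic ∈ cs ] (w (depth i) * (proj₂ ic * δ d (proj₁ ic) i)))
      ≡⟨ ∑-comm vertices cs _ ⟩
    ∑[ ic ∈ cs ] (∑[ i ∈ vertices ] (w (depth i) * (proj₂ ic * δ d (proj₁ ic) i)))
      ≡⟨ ∑-cong cs (λ (i , c) → trans (∑-cong vertices λ j → ℤ*.x∙yz≈y∙xz (w (depth j)) c _)
                                      (∑-*ˡ vertices c λ j → w (depth j) * δ d i j)) ⟩
    ∑[ ic ∈ cs ] (proj₂ ic * ⟪ w , δ d (proj₁ ic) ⟫) ∎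
    where open ≡-Reasoning

  δ-sym : (i j : Vertex d h) → δ d i j ≡ δ d j i
  δ-sym (a , _) (b , _) =
    trans (cong (λ x → (+ d * x - indB (isParentOf b a)) - indB (isParentOf a b))
                (ind-sym (a ≟a b) (b ≟a a)))
          (swap (+ d * ind (b ≟a a)) (indB (isParentOf b a)) (indB (isParentOf a b)))
    where
    swap : ∀ x p q → (x - p) - q ≡ (x - q) - p
    swap = solve-∀

  radial : (ℕ → ℤ) → List (Vertex d h × ℤ)
  radial w = map (λ i → i , w (depth i)) vertices

  comb-radial : (w : ℕ → ℤ) (j : Vertex d h) → comb d (radial w) j ≡ Δ w (depth j)
  comb-radial w j = begin
    comb d (radial w) j                               ≡⟨ comb-∑ (radial w) j ⟩
    ∑[ ic ∈ radial w ] (proj₂ ic * δ d (proj₁ ic) j)  ≡⟨ ∑-map _ vertices _ ⟩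
    ∑[ i ∈ vertices ] (w (depth i) * δ d i j)
      ≡⟨ ∑-cong vertices (λ i → cong (w (depth i) *_) (δ-sym i j)) ⟩
    ⟪ w , δ d j ⟫                                     ≡⟨ ⟪⟫-δ w j ⟩
    Δ w (depth j)                                     ∎
    where open ≡-Reasoning

  Δ-InLattice : (w : ℕ → ℤ) (v : ZV d h) → (∀ j → v j ≡ Δ w (depth j)) → InLattice d h v
  Δ-InLattice w v v≗Δw = radial w , λ j → trans (v≗Δw j) (sym (comb-radial w j))

  InLattice⇒∣⟪⟫∣ : (w : ℕ → ℤ) (M : ℕ) →
                   (∀ t → t ≤ h → Δ w t ≡ + M * ind (t ℕ.≟ 0)) →
                   ∀ {v} → InLattice d h v → M ∣ ℤ.∣ ⟪ w , v ⟫ ∣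
  InLattice⇒∣⟪⟫∣ w M Δw≡M·root {v} (cs , v≗comb) =
    divides ℤ.∣ Z ∣ (trans (cong ℤ.∣_∣ ⟪w,v⟫≡M*Z)
                           (trans (ℤ.abs-* (+ M) Z) (ℕ.*-comm M _)))
    where
    Z = ∑[ ic ∈ cs ] (proj₂ ic * ind (depth (proj₁ ic) ℕ.≟ 0))
    ⟪w,v⟫≡M*Z : ⟪ w , v ⟫ ≡ + M * Z
    ⟪w,v⟫≡M*Z = begin
      ⟪ w , v ⟫                                                       ≡⟨ ⟪⟫-cong w v≗comb ⟩
      ⟪ w , comb d cs ⟫                                               ≡⟨ ⟪⟫-comb w cs ⟩
      ∑[ ic ∈ cs ] (proj₂ ic * ⟪ w , δ d (proj₁ ic) ⟫)                ≡⟨ ∑-cong cs at-root ⟩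
      ∑[ ic ∈ cs ] (proj₂ ic * (+ M * ind (depth (proj₁ ic) ℕ.≟ 0))) ≡⟨ ∑-cong cs swap ⟩
      ∑[ ic ∈ cs ] (+ M * (proj₂ ic * ind (depth (proj₁ ic) ℕ.≟ 0))) ≡⟨ ∑-*ˡ cs (+ M) _ ⟩
      + M * Z                                                         ∎
      where
      open ≡-Reasoning
      at-root : ∀ ((i , c) : Vertex d h × ℤ) →
                c * ⟪ w , δ d i ⟫ ≡ c * (+ M * ind (depth i ℕ.≟ 0))
      at-root (i , c) = cong (c *_) (trans (⟪⟫-δ w i) (Δw≡M·root (depth i) (proj₂ (vertex⁻ i))))
      swap : ∀ ((i , c) : Vertex d h × ℤ) →
             c * (+ M * ind (depth i ℕ.≟ 0)) ≡ + M * (c * ind (depth i ℕ.≟ 0))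
      swap (i , c) = ℤ*.x∙yz≈y∙xz c (+ M) _

geometric : ℕ → ℕ → ℕ
geometric D zero    = 1
geometric D (suc r) = 1 ℕ.+ D ℕ.* geometric D r

geometric-suc : ∀ D r → geometric D (suc r) ≡ geometric D r ℕ.+ D ^ suc r
geometric-suc D zero    = refl
geometric-suc D (suc r) = begin
  1 ℕ.+ D ℕ.* geometric D (suc r)
    ≡⟨ cong (λ g → 1 ℕ.+ D ℕ.* g) (geometric-suc D r) ⟩
  1 ℕ.+ D ℕ.* (geometric D r ℕ.+ D ^ suc r)
    ≡⟨ cong (1 ℕ.+_) (ℕ.*-distribˡ-+ D (geometric D r) _) ⟩
  1 ℕ.+ (D ℕ.* geometric D r ℕ.+ D ^ suc (suc r))
    ≡⟨ ℕ.+-assoc 1 (D ℕ.* geometric D r) _ ⟨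
  geometric D (suc r) ℕ.+ D ^ suc (suc r)
    ∎
  where open ≡-Reasoning

coprime-geometric : ∀ D r → Coprime D (geometric D r)
coprime-geometric D zero    = Coprime.sym (Coprime.1-coprimeTo D)
coprime-geometric D (suc r) {i} (i∣D , i∣1+Dg) =
  ∣1⇒≡1 (∣m+n∣m⇒∣n (subst (i ∣_) (ℕ.+-comm 1 (D ℕ.* geometric D r)) i∣1+Dg)
                    (∣-trans i∣D (m∣m*n (geometric D r))))

coprime-^-divisor : ∀ {a x} e {m} .{{_ : ℕ.NonZero a}} →
                    Coprime a x → a ^ e ∣ m ℕ.* x → a ^ e ∣ m
coprime-^-divisor         zero    {m} _   _        = 1∣ m
coprime-^-divisor {a} {x} (suc e) {m} a⊥x a^1+e∣mx
  with coprime-divisor a⊥x (subst (a ∣_) (ℕ.*-comm m x) (∣-trans (m∣m*n (a ^ e)) a^1+e∣mx))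
... | divides q refl =
  subst (a ^ suc e ∣_) (ℕ.*-comm a q) (*-monoʳ-∣ a (coprime-^-divisor e a⊥x a^e∣qx))
  where
  a^e∣qx : a ^ e ∣ q ℕ.* x
  a^e∣qx = *-cancelˡ-∣ a (subst (a ^ suc e ∣_) (ℕ*.xy∙z≈y∙xz q a x) a^1+e∣mx)

module Weights (D h : ℕ) where
  open import Data.Integer using (_+_; _-_; _*_)
  open FiniteSums
  open Tree (suc D)
  open Radial (suc D) h

  φ : ℕ → ℤ
  φ t = + geometric D (h ∸ t)

  φ⊔ : ℕ → ℕ → ℤ
  φ⊔ n t = φ (t ℕ.⊔ n)

  h∸t≡1+[h∸1+t] : ∀ {t} → t < h → h ∸ t ≡ suc (h ∸ suc t)
  h∸t≡1+[h∸1+t] t<h = ℕ.+-∸-assoc 1 t<h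

  φ-step : ∀ {t} → t < h → φ t ≡ + 1 + + D * φ (suc t)
  φ-step {t} t<h = begin
    φ t                                        ≡⟨ cong (+_ ∘ geometric D) (h∸t≡1+[h∸1+t] t<h) ⟩
    + (1 ℕ.+ D ℕ.* geometric D (h ∸ suc t))    ≡⟨ ℤ.pos-+ 1 _ ⟩
    + 1 + + (D ℕ.* geometric D (h ∸ suc t))    ≡⟨ cong (_+_ (+ 1)) (ℤ.pos-* D _) ⟩
    + 1 + + D * φ (suc t)                      ∎
    where open ≡-Reasoning

  φ-gap : ∀ {t} → t < h → φ t ≡ φ (suc t) + + (D ^ (h ∸ t))
  φ-gap {t} t<h = begin
    φ t                                                 ≡⟨ cong (+_ ∘ geometric D) h∸t≡ ⟩
    + geometric D (suc (h ∸ suc t))                     ≡⟨ cong +_ (geometric-suc D (h ∸ suc t)) ⟩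
    + (geometric D (h ∸ suc t) ℕ.+ D ^ suc (h ∸ suc t)) ≡⟨ ℤ.pos-+ (geometric D (h ∸ suc t)) _ ⟩
    φ (suc t) + + (D ^ suc (h ∸ suc t))                 ≡⟨ cong (λ r → φ (suc t) + + (D ^ r)) h∸t≡ ⟨
    φ (suc t) + + (D ^ (h ∸ t))                         ∎
    where
    open ≡-Reasoning
    h∸t≡ = h∸t≡1+[h∸1+t] t<h

  φ-leaf : φ h ≡ + 1
  φ-leaf = cong (+_ ∘ geometric D) (ℕ.n∸n≡0 h)

  Δ-φ-interior : ∀ s → suc s ≤ h → Δ φ (suc s) ≡ + 0
  Δ-φ-interior s 1+s≤h with ℕ.m≤n⇒m<n∨m≡n 1+s≤h
  ... | inj₁ 1+s<h = trans (Δ-suc φ refl refl refl (ind-yes (suc s ℕ.<? h) 1+s<h))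
                           (balanced (φ-step (ℕ.<⇒≤ 1+s<h)) (φ-step 1+s<h))
    where
    balanced : ∀ {x y z} → x ≡ + 1 + + D * y → y ≡ + 1 + + D * z →
               (+ suc D * y - x) - + 1 * (+ D * z) ≡ + 0
    balanced {z = z} refl refl = ring (+ D) z
      where
      ring : ∀ D z → ((+ 1 + D) * (+ 1 + D * z) - (+ 1 + D * (+ 1 + D * z))) - + 1 * (D * z) ≡ + 0
      ring = solve-∀
  ... | inj₂ refl  = trans (Δ-suc φ refl refl refl (ind-no (suc s ℕ.<? suc s) (ℕ.<-irrefl refl)))
                           (balanced (φ (suc (suc s))) (φ-step ℕ.≤-refl) φ-leaf)
    where
    balanced : ∀ {x y} z → x ≡ + 1 + + D * y → y ≡ + 1 →
               (+ suc D * y - x) - + 0 * (+ D * z) ≡ + 0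
    balanced z refl refl = ring (+ D) z
      where
      ring : ∀ D z → ((+ 1 + D) * + 1 - (+ 1 + D * + 1)) - + 0 * (D * z) ≡ + 0
      ring = solve-∀

  Δ-φ : 0 < h → ∀ t → t ≤ h → Δ φ t ≡ + (suc D ℕ.* D ^ h) * ind (t ℕ.≟ 0)
  Δ-φ 0<h zero    _     =
    trans (Δ-zero φ refl refl (ind-yes (0 ℕ.<? h) 0<h))
          (trans (excess (φ 1) (+ (D ^ h)) (φ-gap 0<h))
                 (cong (_* + 1) (sym (ℤ.pos-* (suc D) (D ^ h)))))
    where
    excess : ∀ {x} z p → x ≡ z + p →
             (+ suc D * x - + 0) - + 1 * (+ suc D * z) ≡ + suc D * p * + 1
    excess z p refl = ring (+ suc D) z p
      where
      ring : ∀ d z p → (d * (z + p) - + 0) - + 1 * (d * z) ≡ d * p * + 1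
      ring = solve-∀
  Δ-φ 0<h (suc s) 1+s≤h = trans (Δ-φ-interior s 1+s≤h) (sym (ℤ.*-zeroʳ (+ (suc D ℕ.* D ^ h))))

  Δ-φ⊔-root : ∀ n → 0 < n → n ≤ h → Δ (φ⊔ n) 0 ≡ + 0
  Δ-φ⊔-root (suc n) _ 1+n≤h =
    trans (Δ-zero (φ⊔ (suc n)) refl refl (ind-yes (0 ℕ.<? h) (ℕ.≤-trans (s≤s z≤n) 1+n≤h)))
          (ring (+ suc D) (φ (suc n)))
    where
    ring : ∀ d x → (d * x - + 0) - + 1 * (d * x) ≡ + 0
    ring = solve-∀

  Δ-φ⊔-below : ∀ {n s} → suc s < n → n ≤ h → Δ (φ⊔ n) (suc s) ≡ + 0
  Δ-φ⊔-below {n} {s} 1+s<n n≤h =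
    trans (Δ-suc (φ⊔ n) (cong φ (ℕ.m≤n⇒m⊔n≡n (ℕ.<⇒≤ (ℕ.<-trans (ℕ.n<1+n s) 1+s<n))))
                        (cong φ (ℕ.m≤n⇒m⊔n≡n (ℕ.<⇒≤ 1+s<n)))
                        (cong φ (ℕ.m≤n⇒m⊔n≡n 1+s<n))
                        (ind-yes (suc s ℕ.<? h) (ℕ.<-≤-trans 1+s<n n≤h)))
          (ring (+ D) (φ n))
    where
    ring : ∀ D x → ((+ 1 + D) * x - x) - + 1 * (D * x) ≡ + 0
    ring = solve-∀

  Δ-φ⊔-above : ∀ {n s} → n < suc s → suc s ≤ h → Δ (φ⊔ n) (suc s) ≡ + 0
  Δ-φ⊔-above {n} {s} n<1+s 1+s≤h =
    trans (Δ-suc (φ⊔ n) (cong φ (ℕ.m≥n⇒m⊔n≡m (ℕ.≤-pred n<1+s)))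
                        (cong φ (ℕ.m≥n⇒m⊔n≡m (ℕ.<⇒≤ n<1+s)))
                        (cong φ (ℕ.m≥n⇒m⊔n≡m (ℕ.m≤n⇒m≤1+n (ℕ.<⇒≤ n<1+s)))) refl)
          (Δ-φ-interior s 1+s≤h)

  Δ-φ⊔-at : ∀ n → suc n ≤ h → Δ (φ⊔ (suc n)) (suc n) ≡ + (D ^ suc (h ∸ suc n))
  Δ-φ⊔-at n 1+n≤h =
    trans (Δ-suc (φ⊔ (suc n)) (cong φ (ℕ.m≤n⇒m⊔n≡n (ℕ.n≤1+n n)))
                              (cong (φ ∘ suc) (ℕ.⊔-idem n))
                              (cong (φ ∘ suc) (ℕ.m≥n⇒m⊔n≡m (ℕ.n≤1+n n))) refl)
          (jump (ℕ.m≤n⇒m<n∨m≡n 1+n≤h))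
    where
    jump : suc n < h ⊎ suc n ≡ h →
           (+ suc D * φ (suc n) - φ (suc n)) - ind (suc n ℕ.<? h) * (+ D * φ (suc (suc n)))
           ≡ + (D ^ suc (h ∸ suc n))
    jump (inj₁ 1+n<h) rewrite ind-yes (suc n ℕ.<? h) 1+n<h =
      trans (gap (φ-gap 1+n<h)) (sym (ℤ.pos-* D _))
      where
      gap : ∀ {x z p} → x ≡ z + p → (+ suc D * x - x) - + 1 * (+ D * z) ≡ + D * p
      gap {z = z} {p} refl = ring (+ D) z p
        where
        ring : ∀ D z p → ((+ 1 + D) * (z + p) - (z + p)) - + 1 * (D * z) ≡ D * p
        ring = solve-∀
    jump (inj₂ refl) rewrite ind-no (suc n ℕ.<? suc n) (ℕ.<-irrefl refl) =
      trans (leaf φ-leaf)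
            (trans (sym (ℤ.pos-* D 1)) (cong (λ r → + (D ^ suc r)) (sym (ℕ.n∸n≡0 n))))
      where
      leaf : ∀ {x} → x ≡ + 1 → (+ suc D * x - x) - + 0 * (+ D * φ (suc (suc n))) ≡ + D * + 1
      leaf refl = ring (+ D) (φ (suc (suc n)))
        where
        ring : ∀ D z → ((+ 1 + D) * + 1 - + 1) - + 0 * (D * z) ≡ D * + 1
        ring = solve-∀

  off-level : ∀ {t n} → t ≢ n → + 0 ≡ + (D ^ suc (h ∸ n)) * ind (t ℕ.≟ n)
  off-level {t} {n} t≢n =
    sym (trans (cong (+ K *_) (ind-no (t ℕ.≟ n) t≢n)) (ℤ.*-zeroʳ (+ K)))
    where
    K = D ^ suc (h ∸ n)

  Δ-φ⊔ : ∀ n → 0 < n → n ≤ h → ∀ t → t ≤ h →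
         Δ (φ⊔ n) t ≡ + (D ^ suc (h ∸ n)) * ind (t ℕ.≟ n)
  Δ-φ⊔ n 0<n n≤h zero _ = trans (Δ-φ⊔-root n 0<n n≤h) (off-level (ℕ.<⇒≢ 0<n))
  Δ-φ⊔ n 0<n n≤h (suc s) 1+s≤h with ℕ.<-cmp (suc s) n
  ... | tri< 1+s<n _ _ = trans (Δ-φ⊔-below 1+s<n n≤h) (off-level (ℕ.<⇒≢ 1+s<n))
  ... | tri> _ _ n<1+s = trans (Δ-φ⊔-above n<1+s 1+s≤h) (off-level (ℕ.>⇒≢ n<1+s))
  ... | tri≈ _ refl _  = trans (Δ-φ⊔-at s 1+s≤h)
      (sym (trans (cong (+ (D ^ suc (h ∸ suc s)) *_) (ind-yes (suc s ℕ.≟ suc s) refl))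
                  (ℤ.*-identityʳ _)))

  y-InLattice : ∀ n → 0 < n → n ≤ h → InLattice (suc D) h ((D ^ suc (h ∸ n)) · y (suc D) h n)
  y-InLattice n 0<n n≤h =
    Δ-InLattice (φ⊔ n) _ λ j → sym (Δ-φ⊔ n 0<n n≤h (depth j) (proj₂ (vertex⁻ j)))

  InLattice-y⇒∣ : .{{_ : ℕ.NonZero D}} → ∀ n m → 0 < n → n ≤ h →
                  InLattice (suc D) h (m · y (suc D) h n) → D ^ suc (h ∸ n) ∣ m
  InLattice-y⇒∣ (suc n) m _ 1+n≤h m·y∈L =
    coprime-^-divisor (suc (h ∸ suc n)) (coprime-geometric D (h ∸ suc n)) (*-cancelˡ-∣ P PK∣PmG)
    where
    P = suc D ℕ.* D ^ n
    G = geometric D (h ∸ suc n)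
    instance
      P≢0 : ℕ.NonZero P
      P≢0 = ℕ.m*n≢0 (suc D) (D ^ n) {{_}} {{ℕ.m^n≢0 D n}}
    ⟪φ,m·y⟫ : ⟪ φ , m · y (suc D) h (suc n) ⟫ ≡ + (m ℕ.* (P ℕ.* G))
    ⟪φ,m·y⟫ = begin
      ⟪ φ , m · y (suc D) h (suc n) ⟫             ≡⟨ ⟪⟫-· φ m _ ⟩
      + m * ⟪ φ , y (suc D) h (suc n) ⟫           ≡⟨ cong (+ m *_) (⟪⟫-y φ (suc n) 1+n≤h) ⟩
      + m * ∑[ a ∈ level (suc n) ] φ (suc n)      ≡⟨ cong (+ m *_) (∑-level-const n (φ (suc n))) ⟩
      + m * (+ P * + G)                           ≡⟨ cong (+ m *_) (ℤ.pos-* P G) ⟨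
      + m * + (P ℕ.* G)                           ≡⟨ ℤ.pos-* m _ ⟨
      + (m ℕ.* (P ℕ.* G))                         ∎
      where open ≡-Reasoning
    M≡PK : suc D ℕ.* D ^ h ≡ P ℕ.* D ^ suc (h ∸ suc n)
    M≡PK = begin
      suc D ℕ.* D ^ h
        ≡⟨ cong (λ e → suc D ℕ.* D ^ e) (ℕ.m+[n∸m]≡n (ℕ.<⇒≤ 1+n≤h)) ⟨
      suc D ℕ.* D ^ (n ℕ.+ (h ∸ n))
        ≡⟨ cong (λ e → suc D ℕ.* D ^ (n ℕ.+ e)) (h∸t≡1+[h∸1+t] 1+n≤h) ⟩
      suc D ℕ.* D ^ (n ℕ.+ suc (h ∸ suc n))
        ≡⟨ cong (suc D ℕ.*_) (ℕ.^-distribˡ-+-* D n _) ⟩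
      suc D ℕ.* (D ^ n ℕ.* D ^ suc (h ∸ suc n))
        ≡⟨ ℕ.*-assoc (suc D) (D ^ n) _ ⟨
      P ℕ.* D ^ suc (h ∸ suc n)
        ∎
      where open ≡-Reasoning
    PK∣PmG : P ℕ.* D ^ suc (h ∸ suc n) ∣ P ℕ.* (m ℕ.* G)
    PK∣PmG = subst₂ _∣_ M≡PK (ℕ*.x∙yz≈y∙xz m P G)
               (subst (λ z → suc D ℕ.* D ^ h ∣ ℤ.∣ z ∣) ⟪φ,m·y⟫
                      (InLattice⇒∣⟪⟫∣ φ _ (Δ-φ (ℕ.≤-trans (s≤s z≤n) 1+n≤h)) m·y∈L))

  order-y : .{{_ : ℕ.NonZero D}} → ∀ n → 0 < n → n ≤ h →
            IsOrderOf (suc D) h (D ^ suc (h ∸ n)) (y (suc D) h n)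
  order-y n 0<n n≤h =
      ℕ.m^n>0 D (suc (h ∸ n))
    , y-InLattice n 0<n n≤h
    , λ m 0<m m<K m·y∈L →
        ℕ.<⇒≱ m<K (∣⇒≤ {{ℕ.>-nonZero 0<m}} (InLattice-y⇒∣ n m 0<n n≤h m·y∈L))

open import Data.Nat using (_+_)

proposition7p7 : (d h n : ℕ) → 3 ≤ d → 1 ≤ h → 1 ≤ n → n ≤ h →
    IsOrderOf d h ((d ∸ 1) ^ (h + 1 ∸ n)) (y d h n)
proposition7p7 .(suc (suc D)) h n (s≤s (s≤s {n = D} _)) _ 1≤n n≤h =
  subst (λ e → IsOrderOf (suc (suc D)) h (suc D ^ e) (y (suc (suc D)) h n))
        (trans (sym (ℕ.+-comm (h ∸ n) 1)) (sym (ℕ.+-∸-comm 1 n≤h)))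
        (Weights.order-y (suc D) h n 1≤n n≤h)
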